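{- For all integers $s,t\ge 2$, the quartet set $Q_{s,t}$ is incompatible.
   Context: For integers $s,t\ge2$, let $\mathcal{L}_{s,t}=\{a_1,\dots,a_s,b_1,\dots,b_t\}$ and $Q_{s,t}=\{a_1b_1|a_sb_t\}\cup\{a_ia_{i+1}|b_jb_{j+1} : 1\le i\le s-1,\ 1\le j\le t-1\}$. A quartet is a binary unrooted phylogenetic tree with four leaves; $ab|cd$ denotes the quartet on $\{a,b,c,d\}$ in which the path between $a$ and $b$ is disjoint from the path between $c$ and $d$. An unrooted phylogenetic tree is a tree with no degree-two vertex whose leaves are bijectively labeled. A tree $T$ displays a tree $T'$ if $T'$ is obtained from the restriction $T|\mathcal{L}(T')$ (minimal subtree spanning the leaves labeled by $\mathcal{L}(T')$, with degree-two vertices suppressed) by contracting edges. A set of quartets is compatible if some unrooted phylogenetic tree displays all of them, and incompatible otherwise. -}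

module Defs where

open import Level using (0ℓ)
open import Data.Bool using (Bool; true; false; if_then_else_)
open import Data.Nat using (ℕ; zero; suc; _≤_; _∸_; _+_)
open import Data.Fin using (Fin; toℕ)
open import Data.Sum using (_⊎_; inj₁; inj₂)
open import Data.Product using (Σ; ∃; _×_; _,_)
open import Data.Unit using (⊤)
open import Data.Maybe using (Maybe; just)
open import Data.List using (List; []; _∷_; length; map; head; last; allFin)
open import Data.Nat.ListAction using (sum)
open import Data.List.Membership.Propositional using (_∈_; _∉_)
open import Data.List.Relation.Unary.Unique.Propositional using (Unique)
open import Relation.Binary.PropositionalEquality using (_≡_; _≢_)
open import Relation.Nullary using (¬_)
open import Function.Definitions using (Injective)

Adj : ℕ → Set
Adj n = Fin n → Fin n → Bool

deg : ∀ {n} → Adj n → Fin n → ℕ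
deg {n} E u = sum (map (λ v → if E u v then 1 else 0) (allFin n))

AdjChain : ∀ {n} → Adj n → List (Fin n) → Set
AdjChain E []           = ⊤
AdjChain E (x ∷ [])     = ⊤
AdjChain E (x ∷ y ∷ r)  = (E x y ≡ true) × AdjChain E (y ∷ r)

Path : ∀ {n} → Adj n → Fin n → Fin n → Set
Path E u v = Σ (List _) λ p →
  (head p ≡ just u) × (last p ≡ just v) × AdjChain E p × Unique p

Cycle : ∀ {n} → Adj n → Set
Cycle E = Σ (List _) λ p → (3 ≤ length p) × AdjChain E p × Unique p ×
  Σ _ λ x → Σ _ λ y → (head p ≡ just x) × (last p ≡ just y) × (E y x ≡ true)

record IsTree {n} (E : Adj n) : Set where
  field
    sym     : ∀ u v → E u v ≡ E v u
    irrefl  : ∀ u → E u u ≡ false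
    conn    : ∀ u v → Path E u v
    acyclic : ¬ Cycle E

IsLeaf : ∀ {n} → Adj n → Fin n → Set
IsLeaf E v = deg E v ≤ 1

record PhyloTree (X : Set) : Set where
  field
    n      : ℕ
    E      : Adj n
    tree   : IsTree E
    noDeg2 : ∀ v → deg E v ≢ 2
    lab    : X → Fin n
    labInj : Injective _≡_ _≡_ lab
    labLeaf : ∀ x → IsLeaf E (lab x)
    leafLab : ∀ v → IsLeaf E v → ∃ λ x → lab x ≡ v

-- Quartets: quartet x y z w stands for  xy|zw

record Quartet (X : Set) : Set where
  constructor _∙_∣_∙_
  field
    q₁ q₂ q₃ q₄ : X

Disjoint : ∀ {n} → List (Fin n) → List (Fin n) → Set
Disjoint p q = ∀ x → x ∈ p → x ∉ q

Displays : ∀ {X} → PhyloTree X → Quartet X → Set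
Displays T (a ∙ b ∣ c ∙ d) =
  Σ (Path E (lab a) (lab b)) λ P → Σ (Path E (lab c) (lab d)) λ Q →
    Disjoint (Data.Product.proj₁ P) (Data.Product.proj₁ Q)
  where open PhyloTree T

mapQ : ∀ {X Y : Set} → (X → Y) → Quartet X → Quartet Y
mapQ f (a ∙ b ∣ c ∙ d) = f a ∙ f b ∣ f c ∙ f d

Compatible : {X : Set} → (Quartet X → Set) → Set₁
Compatible {X} Q = Σ Set λ Y → Σ (X → Y) λ ι → Injective _≡_ _≡_ ι ×
  Σ (PhyloTree Y) λ T → ∀ q → Q q → Displays T (mapQ ι q)

Incompatible : {X : Set} → (Quartet X → Set) → Set₁
Incompatible Q = ¬ Compatible Q

-- The label set L_{s,t} = {a_1..a_s, b_1..b_t}; a_i is aL (i-1), b_j is bL (j-1)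

L : ℕ → ℕ → Set
L s t = Fin s ⊎ Fin t

aL : ∀ {s t} → Fin s → L s t
aL = inj₁

bL : ∀ {s t} → Fin t → L s t
bL = inj₂

data QST (s t : ℕ) : Quartet (L s t) → Set where
  ends  : (i₁ iₛ : Fin s) (j₁ jₜ : Fin t) →
          toℕ i₁ ≡ 0 → toℕ iₛ ≡ s ∸ 1 → toℕ j₁ ≡ 0 → toℕ jₜ ≡ t ∸ 1 →
          QST s t (aL i₁ ∙ bL j₁ ∣ aL iₛ ∙ bL jₜ)
  chain : (i i′ : Fin s) (j j′ : Fin t) →
          suc (toℕ i) ≡ toℕ i′ → suc (toℕ j) ≡ toℕ j′ →
          QST s t (aL i ∙ aL i′ ∣ bL j ∙ bL j′)

{-# OPTIONS --safe #-}
-- Concatenating the paths a_i → a_{i+1} of the quartets a_i a_{i+1} | b_1 b_2 gives a walk A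
-- from a_1 to a_s, and likewise a walk B from b_1 to b_t.  In a forest every vertex and every
-- edge of a path lies on every walk with the same end points; hence the quartets
-- a_i a_{i+1} | b_j b_{j+1} make A and B vertex-disjoint, and every edge of the path
-- a_1 → b_1 is an edge of the walk A, then a_s → b_t, then B backwards.  That path starts on A
-- and ends off A, so the edge on which it leaves A starts at a vertex of the path a_s → b_t,
-- contradicting a_1 b_1 | a_s b_t.
module Submission where

open import Defs
open import Data.Nat using (ℕ; zero; suc; _≤_; z≤n; s≤s)
open import Data.Fin using (Fin; zero; suc; fromℕ; inject₁)
open import Data.Fin.Properties using (_≟_; toℕ-inject₁; toℕ-fromℕ)
open import Data.List using (List; []; _∷_; length; head; last)
open import Data.List.Relation.Unary.Any using (here; there)
open import Data.List.Relation.Unary.All using ([]; lookup)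
open import Data.List.Relation.Unary.All.Properties using (¬Any⇒All¬)
open import Data.List.Relation.Unary.AllPairs using ([]; _∷_)
open import Data.List.Relation.Unary.Unique.Propositional using (Unique)
open import Data.List.Membership.Propositional using (_∈_; _∉_)
open import Data.Sum using (_⊎_; inj₁; inj₂)
open import Data.Product using (Σ; _×_; _,_; proj₁)
open import Data.Bool using (true; false)
open import Data.Empty using (⊥-elim)
open import Data.Unit using (tt)
open import Data.Maybe using (just)
open import Function using (_∘_)
open import Relation.Nullary using (¬_; yes; no; contradiction)
open import Relation.Binary.PropositionalEquality using (_≡_; refl; sym; trans; cong)

module Walks {n : ℕ} (E : Adj n) (E-sym : ∀ u v → E u v ≡ E v u) where

  open import Data.List.Membership.DecPropositional (_≟_ {n}) using (_∈?_)

  V : Set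
  V = Fin n

  Edge : V → V → Set
  Edge u v = E u v ≡ true

  data Walk : V → V → Set where
    [_]    : (x : V) → Walk x x
    _∷⟨_⟩_ : (x : V) {y z : V} → Edge x y → Walk y z → Walk x z

  vertices : ∀ {x y} → Walk x y → List V
  vertices [ x ]        = x ∷ []
  vertices (x ∷⟨ _ ⟩ w) = x ∷ vertices w

  data Step (u v : V) : ∀ {x y} → Walk x y → Set where
    here  : ∀ {z} (e : Edge u v) (w : Walk v z) → Step u v (u ∷⟨ e ⟩ w)
    there : ∀ {x y z} {e : Edge x y} {w : Walk y z} → Step u v w → Step u v (x ∷⟨ e ⟩ w)

  _⊆ˢ_ : ∀ {x y u v} → Walk x y → Walk u v → Set
  p ⊆ˢ w = ∀ {a b} → Step a b p → Step a b w

  head∈ : ∀ {x y} (w : Walk x y) → x ∈ vertices w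
  head∈ [ x ]        = here refl
  head∈ (x ∷⟨ _ ⟩ w) = here refl

  last∈ : ∀ {x y} (w : Walk x y) → y ∈ vertices w
  last∈ [ x ]        = here refl
  last∈ (x ∷⟨ _ ⟩ w) = there (last∈ w)

  step-∈₁ : ∀ {u v x y} {w : Walk x y} → Step u v w → u ∈ vertices w
  step-∈₁ (here _ _) = here refl
  step-∈₁ (there st) = there (step-∈₁ st)

  step-∈₂ : ∀ {u v x y} {w : Walk x y} → Step u v w → v ∈ vertices w
  step-∈₂ (here _ w) = there (head∈ w)
  step-∈₂ (there st) = there (step-∈₂ st)

  step-edge : ∀ {u v x y} {w : Walk x y} → Step u v w → Edge u v
  step-edge (here e _) = e
  step-edge (there st) = step-edge st

  ∈⇒head⊎step : ∀ {z x y} (w : Walk x y) → z ∈ vertices w → z ≡ x ⊎ Σ V λ u → Step u z w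
  ∈⇒head⊎step [ x ]        (here z≡x) = inj₁ z≡x
  ∈⇒head⊎step (x ∷⟨ e ⟩ w) (here z≡x) = inj₁ z≡x
  ∈⇒head⊎step (x ∷⟨ e ⟩ w) (there z∈) with ∈⇒head⊎step w z∈
  ... | inj₁ refl     = inj₂ (x , here e w)
  ... | inj₂ (u , st) = inj₂ (u , there st)

  _++ʷ_ : ∀ {x y z} → Walk x y → Walk y z → Walk x z
  [ x ]        ++ʷ w₂ = w₂
  (x ∷⟨ e ⟩ w₁) ++ʷ w₂ = x ∷⟨ e ⟩ (w₁ ++ʷ w₂)

  step-++ : ∀ {u v x y z} (w₁ : Walk x y) {w₂ : Walk y z} →
            Step u v (w₁ ++ʷ w₂) → Step u v w₁ ⊎ Step u v w₂
  step-++ [ x ]         st          = inj₂ st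
  step-++ (x ∷⟨ e ⟩ w₁) (here _ _)  = inj₁ (here e w₁)
  step-++ (x ∷⟨ e ⟩ w₁) (there st)  with step-++ w₁ st
  ... | inj₁ st₁ = inj₁ (there st₁)
  ... | inj₂ st₂ = inj₂ st₂

  ∈-++ : ∀ {c x y z} (w₁ : Walk x y) {w₂ : Walk y z} →
         c ∈ vertices (w₁ ++ʷ w₂) → c ∈ vertices w₁ ⊎ c ∈ vertices w₂
  ∈-++ [ x ]         c∈         = inj₂ c∈
  ∈-++ (x ∷⟨ e ⟩ w₁) (here c≡x) = inj₁ (here c≡x)
  ∈-++ (x ∷⟨ e ⟩ w₁) (there c∈) with ∈-++ w₁ c∈
  ... | inj₁ c∈₁ = inj₁ (there c∈₁)
  ... | inj₂ c∈₂ = inj₂ c∈₂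

  reverse : ∀ {x y} → Walk x y → Walk y x
  reverse [ x ]                 = [ x ]
  reverse (_∷⟨_⟩_ x {y} e w) = reverse w ++ʷ (y ∷⟨ trans (E-sym y x) e ⟩ [ x ])

  step-reverse : ∀ {u v x y} (w : Walk x y) → Step u v (reverse w) → Step v u w
  step-reverse [ x ] ()
  step-reverse (x ∷⟨ e ⟩ w) st with step-++ (reverse w) st
  ... | inj₁ st′            = there (step-reverse w st′)
  ... | inj₂ (here _ [ _ ]) = here e w

  ∈-reverse : ∀ {c x y} (w : Walk x y) → c ∈ vertices (reverse w) → c ∈ vertices w
  ∈-reverse [ x ]        c∈ = c∈
  ∈-reverse (x ∷⟨ e ⟩ w) c∈ with ∈-++ (reverse w) c∈
  ... | inj₁ c∈w                  = there (∈-reverse w c∈w)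
  ... | inj₂ (here refl)          = there (head∈ w)
  ... | inj₂ (there (here refl))  = here refl

  suffix-from : ∀ {c x y} (w : Walk x y) → c ∈ vertices w →
                Σ (Walk c y) λ w′ → (Unique (vertices w) → Unique (vertices w′)) × w′ ⊆ˢ w
  suffix-from [ x ]        (here refl) = [ x ] , (λ U → U) , (λ st → st)
  suffix-from (x ∷⟨ e ⟩ w) (here refl) = x ∷⟨ e ⟩ w , (λ U → U) , (λ st → st)
  suffix-from (x ∷⟨ e ⟩ w) (there c∈) with suffix-from w c∈
  ... | w′ , uniq , sub = w′ , (λ { (_ ∷ U) → uniq U }) , there ∘ sub

  loop-erase : ∀ {x y} (w : Walk x y) → Σ (Walk x y) λ p → Unique (vertices p) × p ⊆ˢ w
  loop-erase [ x ] = [ x ] , ([] ∷ []) , (λ st → st)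
  loop-erase (x ∷⟨ e ⟩ w) with loop-erase w
  ... | p , U , sub with x ∈? vertices p
  ...   | yes x∈p = let (q , uniq , subq) = suffix-from p x∈p in
                    q , uniq U , there ∘ sub ∘ subq
  ...   | no  x∉p = x ∷⟨ e ⟩ p , (¬Any⇒All¬ _ x∉p ∷ U) , λ { (here _ _) → here e w
                                                            ; (there st) → there (sub st) }

  vertices-nonempty : ∀ {x y} (w : Walk x y) → 1 ≤ length (vertices w)
  vertices-nonempty [ x ]        = s≤s z≤n
  vertices-nonempty (x ∷⟨ _ ⟩ w) = s≤s z≤n

  last-vertices : ∀ {x y} (w : Walk x y) → last (vertices w) ≡ just y
  last-vertices [ x ]                    = refl
  last-vertices (x ∷⟨ _ ⟩ [ y ])         = refl
  last-vertices (x ∷⟨ _ ⟩ (y ∷⟨ e ⟩ w)) = last-vertices (y ∷⟨ e ⟩ w)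

  adjChain-vertices : ∀ {x y} (w : Walk x y) → AdjChain E (vertices w)
  adjChain-vertices [ x ]                    = tt
  adjChain-vertices (x ∷⟨ e ⟩ [ y ])         = e , tt
  adjChain-vertices (x ∷⟨ e ⟩ (y ∷⟨ e′ ⟩ w)) = e , adjChain-vertices (y ∷⟨ e′ ⟩ w)

  walk-of-adjChain : ∀ {u v} (p : List V) → head p ≡ just u → last p ≡ just v → AdjChain E p →
                     Σ (Walk u v) λ w → vertices w ≡ p
  walk-of-adjChain (x ∷ [])    refl refl _        = [ x ] , refl
  walk-of-adjChain (x ∷ y ∷ p) refl l    (e , ch) with walk-of-adjChain (y ∷ p) refl l ch
  ... | w , w≡ = x ∷⟨ e ⟩ w , cong (x ∷_) w≡

  chain-walk : ∀ {m} (g : Fin (suc m) → V) → ((k : Fin m) → Walk (g (inject₁ k)) (g (suc k))) →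
               Walk (g zero) (g (fromℕ m))
  chain-walk {zero}  g links = [ g zero ]
  chain-walk {suc m} g links = links zero ++ʷ chain-walk (g ∘ suc) (links ∘ suc)

  ∈-chain-walk : ∀ {c m} (g : Fin (suc (suc m)) → V) (links : (k : Fin (suc m)) → Walk (g (inject₁ k)) (g (suc k))) →
                 c ∈ vertices (chain-walk g links) → Σ (Fin (suc m)) λ k → c ∈ vertices (links k)
  ∈-chain-walk {m = zero} g links c∈ with ∈-++ (links zero) c∈
  ... | inj₁ c∈₀        = zero , c∈₀
  ... | inj₂ (here refl) = zero , last∈ (links zero)
  ∈-chain-walk {m = suc m} g links c∈ with ∈-++ (links zero) c∈
  ... | inj₁ c∈₀ = zero , c∈₀
  ... | inj₂ c∈  with ∈-chain-walk (g ∘ suc) (links ∘ suc) c∈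
  ...   | k , c∈ₖ = suc k , c∈ₖ

  exit-meets-suffix : ∀ {a b c x y} (A : Walk a b) (M : Walk b c) (p : Walk x y) →
                      p ⊆ˢ (A ++ʷ M) → x ∈ vertices A → y ∉ vertices A →
                      ¬ (∀ z → z ∈ vertices p → z ∈ vertices A → z ∉ vertices M)
  exit-meets-suffix A M [ x ]        _   x∈A y∉A _     = y∉A x∈A
  exit-meets-suffix A M (x ∷⟨ e ⟩ p) sub x∈A y∉A avoid with step-++ A (sub (here e p))
  ... | inj₁ st = exit-meets-suffix A M p (sub ∘ there) (step-∈₂ st) y∉A (λ z → avoid z ∘ there)
  ... | inj₂ st = avoid x (here refl) x∈A (step-∈₁ st)

module Forest {n : ℕ} (E : Adj n) (E-sym : ∀ u v → E u v ≡ E v u)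
              (irrefl : ∀ u → E u u ≡ false) (acyclic : ¬ Cycle E) where

  open Walks E E-sym public

  -- The loop-erased walk is either the edge u → v itself or a path that this edge closes into a cycle.
  edge-step : ∀ {u v} → Edge u v → (w : Walk u v) → Step u v w
  edge-step {u} e w with loop-erase w
  ... | [ _ ] , _ , _ = contradiction (trans (sym e) (irrefl u)) λ ()
  ... | _ ∷⟨ e′ ⟩ [ v ] , _ , sub = sub (here e′ [ v ])
  ... | p@(_ ∷⟨ _ ⟩ (_ ∷⟨ _ ⟩ w₃)) , U , _ = ⊥-elim (acyclic
        (vertices p , s≤s (s≤s (vertices-nonempty w₃)) , adjChain-vertices p , U ,
         u , _ , refl , last-vertices p , trans (E-sym _ u) e))

  split-at-step : ∀ {u v x y} (p : Walk x y) → Unique (vertices p) → Step u v p →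
                  Σ (Walk x u) λ P → Σ (Walk v y) λ S → v ∉ vertices P × u ∉ vertices S
  split-at-step (u ∷⟨ _ ⟩ w) (u∉w ∷ _) (here _ _) =
    [ u ] , w , (λ { (here v≡u) → lookup u∉w (head∈ w) (sym v≡u) }) , (λ u∈w → lookup u∉w u∈w refl)
  split-at-step (x ∷⟨ e ⟩ p) (x∉p ∷ U) (there st) with split-at-step p U st
  ... | P , S , v∉P , u∉S =
    x ∷⟨ e ⟩ P , S , (λ { (here v≡x) → lookup x∉p (step-∈₂ st) (sym v≡x) ; (there v∈P) → v∉P v∈P }) , u∉S

  -- Closing the prefix, w and the suffix into a walk along the edge u → v forces w to use it.
  path-⊆ˢ-walk : ∀ {x y} (p : Walk x y) → Unique (vertices p) → (w : Walk x y) → p ⊆ˢ w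
  path-⊆ˢ-walk p U w st with split-at-step p U st
  ... | P , S , v∉P , u∉S with step-++ (reverse P) (edge-step (step-edge st) (reverse P ++ʷ (w ++ʷ reverse S)))
  ...   | inj₁ stP = ⊥-elim (v∉P (step-∈₁ (step-reverse P stP)))
  ...   | inj₂ st′ with step-++ w st′
  ...     | inj₁ stw = stw
  ...     | inj₂ stS = ⊥-elim (u∉S (step-∈₂ (step-reverse S stS)))

  path-vertex-∈-walk : ∀ {z x y} (p : Walk x y) → Unique (vertices p) → (w : Walk x y) →
                       z ∈ vertices p → z ∈ vertices w
  path-vertex-∈-walk p U w z∈ with ∈⇒head⊎step p z∈
  ... | inj₁ refl     = head∈ w
  ... | inj₂ (_ , st) = step-∈₂ (path-⊆ˢ-walk p U w st)

  record DisjointPaths (a b c d : V) : Set where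
    field
      left         : Walk a b
      right        : Walk c d
      left-unique  : Unique (vertices left)
      right-unique : Unique (vertices right)
      disjoint     : Disjoint (vertices left) (vertices right)

  open DisjointPaths

  disjointPaths : ∀ {a b c d} →
                  (Σ (Path E a b) λ P → Σ (Path E c d) λ Q → Disjoint (proj₁ P) (proj₁ Q)) →
                  DisjointPaths a b c d
  disjointPaths ((p , hp , lp , cp , Up) , (q , hq , lq , cq , Uq) , disj)
    with walk-of-adjChain p hp lp cp | walk-of-adjChain q hq lq cq
  ... | P , refl | Q , refl = record { left = P ; right = Q ; left-unique = Up ; right-unique = Uq ; disjoint = disj }

  ¬separated-chains : ∀ {m m′} (a : Fin (suc (suc m)) → V) (b : Fin (suc (suc m′)) → V) →
                      (∀ k l → DisjointPaths (a (inject₁ k)) (a (suc k)) (b (inject₁ l)) (b (suc l))) →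
                      ¬ DisjointPaths (a zero) (b zero) (a (fromℕ (suc m))) (b (fromℕ (suc m′)))
  ¬separated-chains {m} {m′} a b links outer =
    exit-meets-suffix A M (left outer) (path-⊆ˢ-walk (left outer) (left-unique outer) (A ++ʷ M))
                      (head∈ A) (λ b₀∈A → A∩B=∅ _ b₀∈A (head∈ B)) avoid
    where
    A : Walk (a zero) (a (fromℕ (suc m)))
    A = chain-walk a (λ k → left (links k zero))

    B : Walk (b zero) (b (fromℕ (suc m′)))
    B = chain-walk b (λ l → right (links zero l))

    M : Walk (a (fromℕ (suc m))) (b zero)
    M = right outer ++ʷ reverse B

    A∩B=∅ : Disjoint (vertices A) (vertices B)
    A∩B=∅ z z∈A z∈B with ∈-chain-walk a _ z∈A | ∈-chain-walk b _ z∈B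
    ... | k , z∈aₖ | l , z∈bₗ =
      disjoint (links k l) z
        (path-vertex-∈-walk _ (left-unique (links k zero)) (left (links k l)) z∈aₖ)
        (path-vertex-∈-walk _ (right-unique (links zero l)) (right (links k l)) z∈bₗ)

    avoid : ∀ z → z ∈ vertices (left outer) → z ∈ vertices A → z ∉ vertices M
    avoid z z∈P z∈A z∈M with ∈-++ (right outer) z∈M
    ... | inj₁ z∈Q  = disjoint outer z z∈P z∈Q
    ... | inj₂ z∈B⁻ = A∩B=∅ z z∈A (∈-reverse B z∈B⁻)

lemma3 : (s t : ℕ) → 2 ≤ s → 2 ≤ t → Incompatible (QST s t)
lemma3 0             _             ()       _
lemma3 1             _             (s≤s ()) _
lemma3 (suc (suc _)) 0             _        ()
lemma3 (suc (suc _)) 1             _        (s≤s ())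
lemma3 (suc (suc m)) (suc (suc m′)) _ _ (_ , ι , _ , T , displays) = ¬separated-chains a b links outer
  where
  open PhyloTree T
  open Forest E (IsTree.sym tree) (IsTree.irrefl tree) (IsTree.acyclic tree)

  a : Fin (suc (suc m)) → V
  a i = lab (ι (aL i))

  b : Fin (suc (suc m′)) → V
  b j = lab (ι (bL j))

  links : ∀ k l → DisjointPaths (a (inject₁ k)) (a (suc k)) (b (inject₁ l)) (b (suc l))
  links k l = disjointPaths (displays _ (chain (inject₁ k) (suc k) (inject₁ l) (suc l)
                                          (cong suc (toℕ-inject₁ k)) (cong suc (toℕ-inject₁ l))))

  outer : DisjointPaths (a zero) (b zero) (a (fromℕ (suc m))) (b (fromℕ (suc m′)))
  outer = disjointPaths (displays _ (ends zero (fromℕ _) zero (fromℕ _) refl (toℕ-fromℕ _) refl (toℕ-fromℕ _)))
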